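{- Let $r$ be a nonnegative integer, let $\mathbf{a}=(a_1,a_2,\ldots)$ be a sequence of real numbers with $a_1\neq0$, set $a_0=1$, let $A(t)=\sum_{j\ge1}a_j\frac{t^j}{j!}$ and let $\overline{A}(t)=\sum_{j\ge1}\overline{a}_j\frac{t^j}{j!}$ be its compositional inverse. Then for sequences of real numbers $(U_n)_{n\ge0}$, $(V_n)_{n\ge0}$, $$U_n=\sum_{k=0}^{n}B^{(r)}_{n+r,k+r}\big((a_j);(a_{j-1})\big)V_k\ \text{ for all } n\ge0$$ if and only if $$V_n=\sum_{k=0}^{n}B^{(r)}_{n+r,k+r}\big((\overline{a}_j);((-1)^{j-1}(j-1)!)\big)U_k\ \text{ for all } n\ge0.$$ Here $(a_j)$ denotes the sequence $(a_1,a_2,\ldots)$, $(a_{j-1})$ the sequence $(a_0,a_1,a_2,\ldots)$, $(\overline{a}_j)$ the sequence $(\overline{a}_1,\overline{a}_2,\ldots)$ and $((-1)^{j-1}(j-1)!)$ the sequence whose $j$-th term ($j\ge1$) is $(-1)^{j-1}(j-1)!$.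
   Context: For sequences $\mathbf{a}=(a_1,a_2,\ldots)$, $\mathbf{b}=(b_1,b_2,\ldots)$ and a nonnegative integer $r$, the partial $r$-Bell polynomials $B^{(r)}_{n+r,k+r}(\mathbf{a};\mathbf{b})$ ($n,k\ge0$) are defined by $$\sum_{n\ge k}B^{(r)}_{n+r,k+r}(\mathbf{a};\mathbf{b})\frac{t^n}{n!}=\frac{1}{k!}\Big(\sum_{j\ge1}a_j\frac{t^j}{j!}\Big)^k\Big(\sum_{j\ge0}b_{j+1}\frac{t^j}{j!}\Big)^r,$$ with $B^{(r)}_{n+r,k+r}(\mathbf{a};\mathbf{b})=0$ for $n<k$. -}

module Defs where

open import Level using (Level; _⊔_) renaming (suc to lsuc)
open import Data.Nat as ℕ using (ℕ; zero; suc; _∸_)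
open import Data.Nat using (_!)
open import Algebra.Bundles using (CommutativeRing)
open import Relation.Nullary using (¬_)
open import Function.Bundles using (_⇔_)

-- A commutative ring in which every positive integer is invertible
-- (a ℚ-algebra).  The real numbers are the instance used in the paper.
-- natural number n embedded in a ring: n · 1
ringℕ : ∀ {c ℓ} (R : CommutativeRing c ℓ) → ℕ → CommutativeRing.Carrier R
ringℕ R zero    = CommutativeRing.0# R
ringℕ R (suc n) = CommutativeRing._+_ R (CommutativeRing.1# R) (ringℕ R n)

record QAlgebra (c ℓ : Level) : Set (lsuc (c ⊔ ℓ)) where
  field
    commRing : CommutativeRing c ℓ
  open CommutativeRing commRing public
  ι : ℕ → Carrier
  ι = ringℕ commRing
  field
    inv         : ℕ → Carrier
    inv-correct : ∀ n → ι (suc n) * inv n ≈ 1#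

module _ {c ℓ : Level} (Q : QAlgebra c ℓ) where
  open QAlgebra Q using (Carrier; _≈_; _+_; _*_; -_; 0#; 1#; inv; ι)

  -- formal power series, given by their (ordinary) coefficient sequences
  Series : Set c
  Series = ℕ → Carrier

  sumTo : ℕ → (ℕ → Carrier) → Carrier
  sumTo zero    f = f zero
  sumTo (suc n) f = sumTo n f + f (suc n)

  invFact : ℕ → Carrier
  invFact zero    = 1#
  invFact (suc n) = invFact n * inv n

  _⊛_ : Series → Series → Series
  (f ⊛ g) n = sumTo n (λ i → f i * g (n ∸ i))

  oneS : Series
  oneS zero    = 1#
  oneS (suc n) = 0#

  tS : Series
  tS zero          = 0#
  tS (suc zero)    = 1#
  tS (suc (suc n)) = 0#

  powS : Series → ℕ → Series
  powS f zero    = oneS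
  powS f (suc k) = f ⊛ powS f k

  scaleS : Carrier → Series → Series
  scaleS x f n = x * f n

  -- composition F(G(t)), for G with zero constant term
  _∘S_ : Series → Series → Series
  (F ∘S G) n = sumTo n (λ k → F k * powS G k n)

  egf₁ : (ℕ → Carrier) → Series
  egf₁ a zero    = 0#
  egf₁ a (suc j) = a (suc j) * invFact (suc j)

  egfShift : (ℕ → Carrier) → Series
  egfShift b j = b (suc j) * invFact j

  timesFact : ℕ → Carrier → Carrier
  timesFact n x = ι (n !) * x

  -- Partial r-Bell polynomial  B^{(r)}_{n+r,k+r}(a ; b) :
  -- n! · [t^n] (1/k!) A(t)^k B(t)^r  with  A = Σ_{j≥1} a_j t^j/j!,
  -- B = Σ_{j≥0} b_{j+1} t^j/j!.   Sequences are indexed from 1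
  -- (the value at index 0 is ignored).
  rBell : ℕ → (ℕ → Carrier) → (ℕ → Carrier) → ℕ → ℕ → Carrier
  rBell r a b n k =
    timesFact n (scaleS (invFact k) (powS (egf₁ a) k ⊛ powS (egfShift b) r) n)

  shiftWithOne : (ℕ → Carrier) → ℕ → Carrier
  shiftWithOne a zero          = 0#   -- unused index
  shiftWithOne a (suc zero)    = 1#
  shiftWithOne a (suc (suc j)) = a (suc j)

  signPow : ℕ → Carrier
  signPow zero    = 1#
  signPow (suc m) = - signPow m

  signFact : ℕ → Carrier
  signFact zero    = 0#   -- unused index
  signFact (suc m) = signPow m * ι (m !)

-- The r-Bell matrix B^{(r)}((a_j);(a_{j-1})) is the exponential Riordan array
-- [(1 + A)^r, A] and B^{(r)}((ā_j);((-1)^{j-1}(j-1)!)) is [(1 + t)^{-r}, Ā].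
-- By the fundamental theorem of Riordan arrays, [H, R]·[G, P] = [H·(G∘R), P∘R],
-- so the product of the two is [(1 + t)^{-r}(1 + A∘Ā)^r, A∘Ā] = [1, t], the
-- identity, and likewise in the other order.  Both arrays are lower
-- triangular, so each triangular system is solved by the other array.
module Submission where

open import Defs
open import Data.Nat using (ℕ)
open import Relation.Nullary using (¬_)
open import Function.Bundles using (_⇔_; mk⇔)
open import Data.Nat as ℕ using (zero; suc; _∸_; _≤_; _<_; z≤n; s≤s; _!)
import Data.Nat.Properties as ℕₚ
open import Data.Product using (_,_)
open import Data.Sum using (inj₁; inj₂)
open import Relation.Binary.PropositionalEquality as ≡ using (_≡_)
open import Relation.Binary.Structures using (IsEquivalence)
open import Algebra.Bundles using (CommutativeMonoid)
open import Algebra.Structures using (IsCommutativeMonoid)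
import Algebra.Properties.CommutativeSemigroup as CommutativeSemigroupProperties
import Algebra.Solver.Ring.NaturalCoefficients.Default as NaturalCoefficientsSolver
import Relation.Binary.Reasoning.Setoid as SetoidReasoning

module SeriesAlgebra {c ℓ} (Q : QAlgebra c ℓ) where
  open QAlgebra Q
  open NaturalCoefficientsSolver commutativeSemiring using (solve; _:=_; _:*_)
  open CommutativeSemigroupProperties *-commutativeSemigroup
    using () renaming (x∙yz≈y∙xz to x*yz≈y*xz)
  open import Algebra.Properties.Semiring.Mult semiring using (_×_; ×1-homo-*)
  module ≈-Reasoning = SetoidReasoning setoid

  Σ : ℕ → (ℕ → Carrier) → Carrier
  Σ = sumTo Q

  sumTo-cong-≤ : ∀ n {f g : ℕ → Carrier} → (∀ i → i ≤ n → f i ≈ g i) → Σ n f ≈ Σ n g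
  sumTo-cong-≤ zero    f≈g = f≈g 0 z≤n
  sumTo-cong-≤ (suc n) f≈g =
    +-cong (sumTo-cong-≤ n (λ i i≤n → f≈g i (ℕₚ.m≤n⇒m≤1+n i≤n))) (f≈g (suc n) ℕₚ.≤-refl)

  sumTo-cong : ∀ n {f g : ℕ → Carrier} → (∀ i → f i ≈ g i) → Σ n f ≈ Σ n g
  sumTo-cong n f≈g = sumTo-cong-≤ n (λ i _ → f≈g i)

  sumTo-zero : ∀ n (f : ℕ → Carrier) → (∀ i → i ≤ n → f i ≈ 0#) → Σ n f ≈ 0#
  sumTo-zero zero    f f≈0 = f≈0 0 z≤n
  sumTo-zero (suc n) f f≈0 = trans
    (+-cong (sumTo-zero n f (λ i i≤n → f≈0 i (ℕₚ.m≤n⇒m≤1+n i≤n))) (f≈0 (suc n) ℕₚ.≤-refl))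
    (+-identityˡ 0#)

  sumTo-distrib-+ : ∀ n (f g : ℕ → Carrier) → Σ n (λ i → f i + g i) ≈ Σ n f + Σ n g
  sumTo-distrib-+ zero    f g = refl
  sumTo-distrib-+ (suc n) f g =
    trans (+-congʳ (sumTo-distrib-+ n f g)) (+-interchange _ _ _ _)
    where open CommutativeSemigroupProperties +-commutativeSemigroup
            using () renaming (interchange to +-interchange)

  *-distribˡ-sumTo : ∀ n x (f : ℕ → Carrier) → x * Σ n f ≈ Σ n (λ i → x * f i)
  *-distribˡ-sumTo zero    x f = refl
  *-distribˡ-sumTo (suc n) x f = trans (distribˡ x (Σ n f) (f (suc n))) (+-congʳ (*-distribˡ-sumTo n x f))

  *-distribʳ-sumTo : ∀ n x (f : ℕ → Carrier) → Σ n f * x ≈ Σ n (λ i → f i * x)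
  *-distribʳ-sumTo n x f =
    trans (*-comm _ x) (trans (*-distribˡ-sumTo n x f) (sumTo-cong n (λ i → *-comm x (f i))))

  sumTo-sucˡ : ∀ n (f : ℕ → Carrier) → Σ (suc n) f ≈ f 0 + Σ n (λ i → f (suc i))
  sumTo-sucˡ zero    f = refl
  sumTo-sucˡ (suc n) f = trans (+-congʳ (sumTo-sucˡ n f)) (+-assoc _ _ _)

  sumTo-comm : ∀ n m (f : ℕ → ℕ → Carrier) →
    Σ n (λ i → Σ m (f i)) ≈ Σ m (λ j → Σ n (λ i → f i j))
  sumTo-comm zero    m f = refl
  sumTo-comm (suc n) m f =
    trans (+-congʳ (sumTo-comm n m f)) (sym (sumTo-distrib-+ m _ (f (suc n))))

  sumTo-extend : ∀ n N (f : ℕ → Carrier) → n ≤ N → (∀ k → n < k → f k ≈ 0#) → Σ n f ≈ Σ N f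
  sumTo-extend n zero    f z≤n   _   = refl
  sumTo-extend n (suc N) f n≤1+N f≈0 with ℕₚ.m≤n⇒m<n∨m≡n n≤1+N
  ... | inj₂ ≡.refl      = refl
  ... | inj₁ (s≤s n≤N) = trans (sumTo-extend n N f n≤N f≈0)
    (trans (sym (+-identityʳ _)) (+-congˡ (sym (f≈0 (suc N) (s≤s n≤N)))))

  sumTo-last : ∀ n (f : ℕ → Carrier) → (∀ m → m < n → f m ≈ 0#) → Σ n f ≈ f n
  sumTo-last zero    f _   = refl
  sumTo-last (suc n) f f≈0 = trans (+-congʳ (sumTo-zero n f (λ i i≤n → f≈0 i (s≤s i≤n)))) (+-identityˡ _)

  sumTo-reverse : ∀ n (f : ℕ → Carrier) → Σ n f ≈ Σ n (λ i → f (n ∸ i))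
  sumTo-reverse zero    f = refl
  sumTo-reverse (suc n) f =
    trans (+-comm _ _) (trans (+-congˡ (sumTo-reverse n f)) (sym (sumTo-sucˡ n (λ i → f (suc n ∸ i)))))

  sumTo-triangle : ∀ n (f : ℕ → ℕ → Carrier) →
    Σ n (λ k → Σ k (λ i → f i (k ∸ i))) ≈ Σ n (λ i → Σ (n ∸ i) (f i))
  sumTo-triangle zero    f = refl
  sumTo-triangle (suc n) f = begin
    Σ n (λ k → Σ k (λ i → f i (k ∸ i))) + (Σ n (λ i → f i (suc n ∸ i)) + f (suc n) (n ∸ n))
      ≈⟨ +-congʳ (sumTo-triangle n f) ⟩
    Σ n (λ i → Σ (n ∸ i) (f i)) + (Σ n (λ i → f i (suc n ∸ i)) + f (suc n) (n ∸ n))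
      ≈⟨ sym (+-assoc _ _ _) ⟩
    (Σ n (λ i → Σ (n ∸ i) (f i)) + Σ n (λ i → f i (suc n ∸ i))) + f (suc n) (n ∸ n)
      ≈⟨ +-congʳ (sym (sumTo-distrib-+ n _ _)) ⟩
    Σ n (λ i → Σ (n ∸ i) (f i) + f i (suc n ∸ i)) + f (suc n) (n ∸ n)
      ≈⟨ +-cong (sumTo-cong-≤ n row) corner ⟩
    Σ n (λ i → Σ (suc n ∸ i) (f i)) + Σ (n ∸ n) (f (suc n)) ∎
    where
    open ≈-Reasoning
    row : ∀ i → i ≤ n → Σ (n ∸ i) (f i) + f i (suc n ∸ i) ≈ Σ (suc n ∸ i) (f i)
    row i i≤n rewrite ℕₚ.+-∸-assoc 1 i≤n = refl
    corner : f (suc n) (n ∸ n) ≈ Σ (n ∸ n) (f (suc n))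
    corner rewrite ℕₚ.n∸n≡0 n = refl

  infix  4 _≋_
  infixl 6 _+ₛ_
  infixl 7 _*ₛ_
  infixr 8 _^ₛ_
  infixl 9 _∘ₛ_

  _≋_ : Series Q → Series Q → Set ℓ
  F ≋ G = ∀ n → F n ≈ G n

  _+ₛ_ : Series Q → Series Q → Series Q
  (F +ₛ G) n = F n + G n

  _*ₛ_ : Series Q → Series Q → Series Q
  _*ₛ_ = _⊛_ Q

  _^ₛ_ : Series Q → ℕ → Series Q
  _^ₛ_ = powS Q

  _∘ₛ_ : Series Q → Series Q → Series Q
  _∘ₛ_ = _∘S_ Q

  1ₛ tₛ : Series Q
  1ₛ = oneS Q
  tₛ = tS Q

  ≋-isEquivalence : IsEquivalence _≋_
  ≋-isEquivalence = record
    { refl  = λ _ → refl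
    ; sym   = λ F≋G n → sym (F≋G n)
    ; trans = λ F≋G G≋H n → trans (F≋G n) (G≋H n)
    }

  open IsEquivalence ≋-isEquivalence using ()
    renaming (refl to ≋-refl; sym to ≋-sym; trans to ≋-trans)

  +ₛ-cong : ∀ {F F′ G G′} → F ≋ F′ → G ≋ G′ → F +ₛ G ≋ F′ +ₛ G′
  +ₛ-cong F≋F′ G≋G′ n = +-cong (F≋F′ n) (G≋G′ n)

  *ₛ-cong : ∀ {F F′ G G′} → F ≋ F′ → G ≋ G′ → F *ₛ G ≋ F′ *ₛ G′
  *ₛ-cong F≋F′ G≋G′ n = sumTo-cong n (λ i → *-cong (F≋F′ i) (G≋G′ (n ∸ i)))

  *ₛ-comm : ∀ F G → F *ₛ G ≋ G *ₛ F
  *ₛ-comm F G n = trans (sumTo-reverse n _) (sumTo-cong-≤ n (λ i i≤n →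
    trans (*-comm _ _) (*-congʳ (reflexive (≡.cong G (ℕₚ.m∸[m∸n]≡n i≤n))))))

  *ₛ-assoc : ∀ F G H → (F *ₛ G) *ₛ H ≋ F *ₛ (G *ₛ H)
  *ₛ-assoc F G H n = begin
    Σ n (λ k → Σ k (λ i → F i * G (k ∸ i)) * H (n ∸ k))
      ≈⟨ sumTo-cong n (λ k → trans (*-distribʳ-sumTo k _ _) (sumTo-cong-≤ k (regroup k))) ⟩
    Σ n (λ k → Σ k (λ i → φ i (k ∸ i)))
      ≈⟨ sumTo-triangle n φ ⟩
    Σ n (λ i → Σ (n ∸ i) (φ i))
      ≈⟨ sumTo-cong n (λ i → sym (*-distribˡ-sumTo (n ∸ i) (F i) _)) ⟩
    Σ n (λ i → F i * Σ (n ∸ i) (λ j → G j * H (n ∸ (i ℕ.+ j))))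
      ≈⟨ sumTo-cong n (λ i → *-congˡ (sumTo-cong (n ∸ i) (λ j →
           *-congˡ (reflexive (≡.cong H (≡.sym (ℕₚ.∸-+-assoc n i j))))))) ⟩
    (F *ₛ (G *ₛ H)) n ∎
    where
    open ≈-Reasoning
    φ : ℕ → ℕ → Carrier
    φ i j = F i * (G j * H (n ∸ (i ℕ.+ j)))
    regroup : ∀ k i → i ≤ k → F i * G (k ∸ i) * H (n ∸ k) ≈ φ i (k ∸ i)
    regroup k i i≤k = trans (*-assoc _ _ _)
      (*-congˡ (*-congˡ (reflexive (≡.cong (λ e → H (n ∸ e)) (≡.sym (ℕₚ.m+[n∸m]≡n i≤k))))))

  *ₛ-identityˡ : ∀ F → 1ₛ *ₛ F ≋ F
  *ₛ-identityˡ F zero    = *-identityˡ _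
  *ₛ-identityˡ F (suc n) = trans (sumTo-sucˡ n _)
    (trans (+-cong (*-identityˡ _) (sumTo-zero n _ (λ i _ → zeroˡ _))) (+-identityʳ _))

  *ₛ-identityʳ : ∀ F → F *ₛ 1ₛ ≋ F
  *ₛ-identityʳ F = ≋-trans (*ₛ-comm F 1ₛ) (*ₛ-identityˡ F)

  *ₛ-distribʳ-+ₛ : ∀ F G H → (F +ₛ G) *ₛ H ≋ F *ₛ H +ₛ G *ₛ H
  *ₛ-distribʳ-+ₛ F G H n = trans (sumTo-cong n (λ i → distribʳ _ _ _)) (sumTo-distrib-+ n _ _)

  *ₛ-isCommutativeMonoid : IsCommutativeMonoid _≋_ _*ₛ_ 1ₛ
  *ₛ-isCommutativeMonoid = record
    { isMonoid = record
      { isSemigroup = record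
        { isMagma = record { isEquivalence = ≋-isEquivalence ; ∙-cong = *ₛ-cong }
        ; assoc   = *ₛ-assoc
        }
      ; identity = *ₛ-identityˡ , *ₛ-identityʳ
      }
    ; comm = *ₛ-comm
    }

  *ₛ-commutativeMonoid : CommutativeMonoid c ℓ
  *ₛ-commutativeMonoid = record { isCommutativeMonoid = *ₛ-isCommutativeMonoid }

  open CommutativeMonoid *ₛ-commutativeMonoid using ()
    renaming (∙-congˡ to *ₛ-congˡ; ∙-congʳ to *ₛ-congʳ)
  open CommutativeSemigroupProperties (CommutativeMonoid.commutativeSemigroup *ₛ-commutativeMonoid)
    using () renaming (interchange to *ₛ-interchange; x∙yz≈y∙xz to *ₛ-leftComm)
  module ≋-Reasoning = SetoidReasoning (CommutativeMonoid.setoid *ₛ-commutativeMonoid)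

  sumTo-tₛ-* : ∀ m (g : ℕ → Carrier) → Σ (suc m) (λ k → tₛ k * g k) ≈ g 1
  sumTo-tₛ-* m g = trans (sumTo-sucˡ m _) (trans (+-cong (zeroˡ _) (tail m)) (+-identityˡ _))
    where
    tail : ∀ m → Σ m (λ k → tₛ (suc k) * g (suc k)) ≈ g 1
    tail zero    = *-identityˡ _
    tail (suc m) = trans (sumTo-sucˡ m _)
      (trans (+-cong (*-identityˡ _) (sumTo-zero m _ (λ _ _ → zeroˡ _))) (+-identityʳ _))

  tₛ-*ₛ-suc : ∀ F n → (tₛ *ₛ F) (suc n) ≈ F n
  tₛ-*ₛ-suc F n = sumTo-tₛ-* n (λ i → F (suc n ∸ i))

  ^ₛ-cong : ∀ {F G} k → F ≋ G → F ^ₛ k ≋ G ^ₛ k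
  ^ₛ-cong zero    F≋G = ≋-refl
  ^ₛ-cong (suc k) F≋G = *ₛ-cong F≋G (^ₛ-cong k F≋G)

  ^ₛ-+ : ∀ F i j → F ^ₛ (i ℕ.+ j) ≋ F ^ₛ i *ₛ F ^ₛ j
  ^ₛ-+ F zero    j = ≋-sym (*ₛ-identityˡ _)
  ^ₛ-+ F (suc i) j = ≋-trans (*ₛ-congˡ (^ₛ-+ F i j)) (≋-sym (*ₛ-assoc F (F ^ₛ i) (F ^ₛ j)))

  *ₛ-^ₛ : ∀ F G k → (F *ₛ G) ^ₛ k ≋ F ^ₛ k *ₛ G ^ₛ k
  *ₛ-^ₛ F G zero    = ≋-sym (*ₛ-identityˡ 1ₛ)
  *ₛ-^ₛ F G (suc k) = ≋-trans (*ₛ-congˡ (*ₛ-^ₛ F G k)) (*ₛ-interchange F G (F ^ₛ k) (G ^ₛ k))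

  1ₛ-^ₛ : ∀ k → 1ₛ ^ₛ k ≋ 1ₛ
  1ₛ-^ₛ zero    = ≋-refl
  1ₛ-^ₛ (suc k) = ≋-trans (*ₛ-congˡ (1ₛ-^ₛ k)) (*ₛ-identityˡ 1ₛ)

  ^ₛ-coeff-< : ∀ {F} → F 0 ≈ 0# → ∀ {n k} → n < k → (F ^ₛ k) n ≈ 0#
  ^ₛ-coeff-< {F} F₀ {n} {suc k} (s≤s n≤k) = sumTo-zero n _ term≈0
    where
    term≈0 : ∀ i → i ≤ n → F i * (F ^ₛ k) (n ∸ i) ≈ 0#
    term≈0 zero    _      = trans (*-congʳ F₀) (zeroˡ _)
    term≈0 (suc i) 1+i≤n = trans (*-congˡ (^ₛ-coeff-< F₀
      (ℕₚ.<-≤-trans (ℕₚ.∸-monoʳ-< (s≤s z≤n) 1+i≤n) n≤k))) (zeroʳ _)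

  tₛ-^ₛ-coeff-> : ∀ {m n} → m < n → (tₛ ^ₛ m) n ≈ 0#
  tₛ-^ₛ-coeff-> {zero}  {suc n} _         = refl
  tₛ-^ₛ-coeff-> {suc m} {suc n} (s≤s m<n) = trans (tₛ-*ₛ-suc (tₛ ^ₛ m) n) (tₛ-^ₛ-coeff-> m<n)

  tₛ-^ₛ-coeff-≡ : ∀ n → (tₛ ^ₛ n) n ≈ 1#
  tₛ-^ₛ-coeff-≡ zero    = refl
  tₛ-^ₛ-coeff-≡ (suc n) = trans (tₛ-*ₛ-suc (tₛ ^ₛ n) n) (tₛ-^ₛ-coeff-≡ n)

  ∘ₛ-congˡ : ∀ {F F′} H → F ≋ F′ → F ∘ₛ H ≋ F′ ∘ₛ H
  ∘ₛ-congˡ H F≋F′ n = sumTo-cong n (λ k → *-congʳ (F≋F′ k))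

  ∘ₛ-coeff-extend : ∀ {H} → H 0 ≈ 0# → ∀ F {n N} → n ≤ N →
    (F ∘ₛ H) n ≈ Σ N (λ k → F k * (H ^ₛ k) n)
  ∘ₛ-coeff-extend H₀ F {n} {N} n≤N =
    sumTo-extend n N _ n≤N (λ k n<k → trans (*-congˡ (^ₛ-coeff-< H₀ n<k)) (zeroʳ _))

  +ₛ-∘ₛ : ∀ F G H → (F +ₛ G) ∘ₛ H ≋ F ∘ₛ H +ₛ G ∘ₛ H
  +ₛ-∘ₛ F G H n = trans (sumTo-cong n (λ k → distribʳ _ _ _)) (sumTo-distrib-+ n _ _)

  1ₛ-∘ₛ : ∀ H → 1ₛ ∘ₛ H ≋ 1ₛ
  1ₛ-∘ₛ H zero    = *-identityˡ _
  1ₛ-∘ₛ H (suc n) = trans (sumTo-sucˡ n _)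
    (trans (+-cong (zeroʳ _) (sumTo-zero n _ (λ i _ → zeroˡ _))) (+-identityʳ _))

  tₛ-∘ₛ : ∀ {H} → H 0 ≈ 0# → tₛ ∘ₛ H ≋ H
  tₛ-∘ₛ     H₀ zero    = trans (zeroˡ _) (sym H₀)
  tₛ-∘ₛ {H} H₀ (suc n) = trans (sumTo-tₛ-* n _) (*ₛ-identityʳ H (suc n))

  sumTo-*ₛ-^ₛ : ∀ {H} → H 0 ≈ 0# → ∀ F D n →
    Σ n (λ k → F k * (D *ₛ H ^ₛ k) n) ≈ (D *ₛ F ∘ₛ H) n
  sumTo-*ₛ-^ₛ {H} H₀ F D n = begin
    Σ n (λ k → F k * Σ n (λ l → D l * (H ^ₛ k) (n ∸ l)))
      ≈⟨ sumTo-cong n (λ k → *-distribˡ-sumTo n (F k) _) ⟩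
    Σ n (λ k → Σ n (λ l → F k * (D l * (H ^ₛ k) (n ∸ l))))
      ≈⟨ sumTo-comm n n _ ⟩
    Σ n (λ l → Σ n (λ k → F k * (D l * (H ^ₛ k) (n ∸ l))))
      ≈⟨ sumTo-cong n (λ l → sumTo-cong n (λ k → x*yz≈y*xz (F k) (D l) _)) ⟩
    Σ n (λ l → Σ n (λ k → D l * (F k * (H ^ₛ k) (n ∸ l))))
      ≈⟨ sumTo-cong n (λ l → sym (*-distribˡ-sumTo n (D l) _)) ⟩
    Σ n (λ l → D l * Σ n (λ k → F k * (H ^ₛ k) (n ∸ l)))
      ≈⟨ sumTo-cong n (λ l → *-congˡ (sym (∘ₛ-coeff-extend H₀ F (ℕₚ.m∸n≤m n l)))) ⟩
    (D *ₛ F ∘ₛ H) n ∎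
    where open ≈-Reasoning

  *ₛ-∘ₛ : ∀ {H} → H 0 ≈ 0# → ∀ F G → (F *ₛ G) ∘ₛ H ≋ F ∘ₛ H *ₛ G ∘ₛ H
  *ₛ-∘ₛ {H} H₀ F G n = begin
    Σ n (λ k → Σ k (λ i → F i * G (k ∸ i)) * (H ^ₛ k) n)
      ≈⟨ sumTo-cong n (λ k → trans (*-distribʳ-sumTo k _ _) (sumTo-cong-≤ k (regroup k))) ⟩
    Σ n (λ k → Σ k (λ i → φ i (k ∸ i)))
      ≈⟨ sumTo-triangle n φ ⟩
    Σ n (λ i → Σ (n ∸ i) (φ i))
      ≈⟨ sumTo-cong-≤ n (λ i i≤n → trans (sym (*-distribˡ-sumTo (n ∸ i) (F i) _)) (*-congˡ (row i i≤n))) ⟩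
    Σ n (λ i → F i * (G ∘ₛ H *ₛ H ^ₛ i) n)
      ≈⟨ sumTo-*ₛ-^ₛ H₀ F (G ∘ₛ H) n ⟩
    (G ∘ₛ H *ₛ F ∘ₛ H) n
      ≈⟨ *ₛ-comm (G ∘ₛ H) (F ∘ₛ H) n ⟩
    (F ∘ₛ H *ₛ G ∘ₛ H) n ∎
    where
    open ≈-Reasoning
    φ : ℕ → ℕ → Carrier
    φ i j = F i * (G j * (H ^ₛ (i ℕ.+ j)) n)
    regroup : ∀ k i → i ≤ k → F i * G (k ∸ i) * (H ^ₛ k) n ≈ φ i (k ∸ i)
    regroup k i i≤k = trans (*-assoc _ _ _)
      (*-congˡ (*-congˡ (reflexive (≡.cong (λ e → (H ^ₛ e) n) (≡.sym (ℕₚ.m+[n∸m]≡n i≤k))))))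
    row : ∀ i → i ≤ n → Σ (n ∸ i) (λ j → G j * (H ^ₛ (i ℕ.+ j)) n) ≈ (G ∘ₛ H *ₛ H ^ₛ i) n
    row i i≤n = begin
      Σ (n ∸ i) (λ j → G j * (H ^ₛ (i ℕ.+ j)) n)
        ≈⟨ sumTo-extend (n ∸ i) n _ (ℕₚ.m∸n≤m n i) (λ j n∸i<j →
             trans (*-congˡ (^ₛ-coeff-< H₀ (beyond j n∸i<j))) (zeroʳ _)) ⟩
      Σ n (λ j → G j * (H ^ₛ (i ℕ.+ j)) n)
        ≈⟨ sumTo-cong n (λ j → *-congˡ (^ₛ-+ H i j n)) ⟩
      Σ n (λ j → G j * (H ^ₛ i *ₛ H ^ₛ j) n)
        ≈⟨ sumTo-*ₛ-^ₛ H₀ G (H ^ₛ i) n ⟩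
      (H ^ₛ i *ₛ G ∘ₛ H) n
        ≈⟨ *ₛ-comm (H ^ₛ i) (G ∘ₛ H) n ⟩
      (G ∘ₛ H *ₛ H ^ₛ i) n ∎
      where
      beyond : ∀ j → n ∸ i < j → n < i ℕ.+ j
      beyond j n∸i<j = ≡.subst (_< i ℕ.+ j) (ℕₚ.m+[n∸m]≡n i≤n) (ℕₚ.+-monoʳ-< i n∸i<j)

  ^ₛ-∘ₛ : ∀ {H} → H 0 ≈ 0# → ∀ F k → (F ^ₛ k) ∘ₛ H ≋ (F ∘ₛ H) ^ₛ k
  ^ₛ-∘ₛ {H} H₀ F zero    = 1ₛ-∘ₛ H
  ^ₛ-∘ₛ {H} H₀ F (suc k) = ≋-trans (*ₛ-∘ₛ H₀ F (F ^ₛ k)) (*ₛ-congˡ (^ₛ-∘ₛ H₀ F k))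

  *ₛ-inverse-∘ₛ : ∀ {H} → H 0 ≈ 0# → ∀ {F G} → F *ₛ G ≋ 1ₛ → F ∘ₛ H *ₛ G ∘ₛ H ≋ 1ₛ
  *ₛ-inverse-∘ₛ {H} H₀ {F} {G} FG≋1 =
    ≋-trans (≋-sym (*ₛ-∘ₛ H₀ F G)) (≋-trans (∘ₛ-congˡ H FG≋1) (1ₛ-∘ₛ H))

  ^ₛ-inverse-∘ₛ : ∀ {R} → R 0 ≈ 0# → ∀ {G H} r → H *ₛ G ∘ₛ R ≋ 1ₛ → H ^ₛ r *ₛ (G ^ₛ r) ∘ₛ R ≋ 1ₛ
  ^ₛ-inverse-∘ₛ {R} R₀ {G} {H} r HG≋1 = begin
    H ^ₛ r *ₛ (G ^ₛ r) ∘ₛ R   ≈⟨ *ₛ-congˡ (^ₛ-∘ₛ R₀ G r) ⟩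
    H ^ₛ r *ₛ (G ∘ₛ R) ^ₛ r   ≈⟨ ≋-sym (*ₛ-^ₛ H (G ∘ₛ R) r) ⟩
    (H *ₛ G ∘ₛ R) ^ₛ r        ≈⟨ ^ₛ-cong r HG≋1 ⟩
    1ₛ ^ₛ r                   ≈⟨ 1ₛ-^ₛ r ⟩
    1ₛ                        ∎
    where open ≋-Reasoning

  ι≡×1# : ∀ n → ι n ≡ n × 1#
  ι≡×1# zero    = ≡.refl
  ι≡×1# (suc n) = ≡.cong (1# +_) (ι≡×1# n)

  ι-* : ∀ m n → ι (m ℕ.* n) ≈ ι m * ι n
  ι-* m n = trans (reflexive (ι≡×1# (m ℕ.* n)))
    (trans (×1-homo-* m n) (reflexive (≡.cong₂ _*_ (≡.sym (ι≡×1# m)) (≡.sym (ι≡×1# n)))))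

  ι-!-*-invFact : ∀ n → ι (n !) * invFact Q n ≈ 1#
  ι-!-*-invFact zero    = trans (*-identityʳ _) (+-identityʳ _)
  ι-!-*-invFact (suc n) = begin
    ι (suc n ℕ.* n !) * (invFact Q n * inv n)
      ≈⟨ *-congʳ (ι-* (suc n) (n !)) ⟩
    (ι (suc n) * ι (n !)) * (invFact Q n * inv n)
      ≈⟨ solve 4 (λ a b c d → (a :* b) :* (c :* d) := (b :* c) :* (a :* d))
               refl (ι (suc n)) (ι (n !)) (invFact Q n) (inv n) ⟩
    (ι (n !) * invFact Q n) * (ι (suc n) * inv n)
      ≈⟨ *-cong (ι-!-*-invFact n) (inv-correct n) ⟩
    1# * 1#
      ≈⟨ *-identityʳ _ ⟩
    1# ∎
    where open ≈-Reasoning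

  -- The exponential Riordan array [G, P]; rBell Q r a b is definitionally
  -- riordan (egfShift Q b ^ₛ r) (egf₁ Q a).
  riordan : Series Q → Series Q → ℕ → ℕ → Carrier
  riordan G P n k = ι (n !) * (invFact Q k * (P ^ₛ k *ₛ G) n)

  riordan-cong : ∀ {G G′ P P′} → G ≋ G′ → P ≋ P′ → ∀ n k → riordan G P n k ≈ riordan G′ P′ n k
  riordan-cong G≋G′ P≋P′ n k = *-congˡ (*-congˡ (*ₛ-cong (^ₛ-cong k P≋P′) G≋G′ n))

  riordan-lowerTriangular : ∀ {P} → P 0 ≈ 0# → ∀ G {k m} → k < m → riordan G P k m ≈ 0#
  riordan-lowerTriangular P₀ G {k} k<m = trans (*-congˡ (trans (*-congˡ (sumTo-zero k _ (λ l l≤k →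
    trans (*-congʳ (^ₛ-coeff-< P₀ (ℕₚ.≤-<-trans l≤k k<m))) (zeroˡ _)))) (zeroʳ _))) (zeroʳ _)

  riordan-* : ∀ {R} → R 0 ≈ 0# → ∀ H G P n m →
    Σ n (λ k → riordan H R n k * riordan G P k m) ≈ riordan (H *ₛ G ∘ₛ R) (P ∘ₛ R) n m
  riordan-* {R} R₀ H G P n m = begin
    Σ n (λ k → riordan H R n k * riordan G P k m)  ≈⟨ sumTo-cong n cancel ⟩
    Σ n (λ k → scale * (X k * (H *ₛ R ^ₛ k) n))    ≈⟨ sym (*-distribˡ-sumTo n scale _) ⟩
    scale * Σ n (λ k → X k * (H *ₛ R ^ₛ k) n)      ≈⟨ *-congˡ (sumTo-*ₛ-^ₛ R₀ X H n) ⟩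
    scale * (H *ₛ X ∘ₛ R) n                         ≈⟨ *-congˡ (composite n) ⟩
    scale * ((P ∘ₛ R) ^ₛ m *ₛ (H *ₛ G ∘ₛ R)) n     ≈⟨ *-assoc _ _ _ ⟩
    riordan (H *ₛ G ∘ₛ R) (P ∘ₛ R) n m ∎
    where
    open ≈-Reasoning
    scale : Carrier
    scale = ι (n !) * invFact Q m
    X : Series Q
    X = P ^ₛ m *ₛ G
    cancel : ∀ k → riordan H R n k * riordan G P k m ≈ scale * (X k * (H *ₛ R ^ₛ k) n)
    cancel k = trans
      (solve 6 (λ a b c d e f → (a :* (b :* c)) :* (d :* (e :* f)) := ((a :* e) :* (f :* c)) :* (d :* b))
             refl (ι (n !)) (invFact Q k) ((R ^ₛ k *ₛ H) n) (ι (k !)) (invFact Q m) (X k))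
      (trans (*-congˡ (ι-!-*-invFact k))
      (trans (*-identityʳ _) (*-congˡ (*-congˡ (*ₛ-comm (R ^ₛ k) H n)))))
    composite : H *ₛ X ∘ₛ R ≋ (P ∘ₛ R) ^ₛ m *ₛ (H *ₛ G ∘ₛ R)
    composite = ≋-trans (*ₛ-congˡ (≋-trans (*ₛ-∘ₛ R₀ (P ^ₛ m) G) (*ₛ-congʳ {G ∘ₛ R} (^ₛ-∘ₛ R₀ P m))))
                        (*ₛ-leftComm H ((P ∘ₛ R) ^ₛ m) (G ∘ₛ R))

  riordan-identity-< : ∀ {n m} → m < n → riordan 1ₛ tₛ n m ≈ 0#
  riordan-identity-< {n} {m} m<n = trans (*-congˡ (trans
    (*-congˡ (trans (*ₛ-identityʳ (tₛ ^ₛ m) n) (tₛ-^ₛ-coeff-> m<n))) (zeroʳ _))) (zeroʳ _)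

  riordan-identity-≡ : ∀ n → riordan 1ₛ tₛ n n ≈ 1#
  riordan-identity-≡ n = trans (*-congˡ (trans
    (*-congˡ (trans (*ₛ-identityʳ (tₛ ^ₛ n) n) (tₛ-^ₛ-coeff-≡ n))) (*-identityʳ _))) (ι-!-*-invFact n)

  lowerTriangular-leftInverse-solve : ∀ (M N : ℕ → ℕ → Carrier) →
    (∀ {k m} → k < m → M k m ≈ 0#) →
    (∀ {n m} → m < n → Σ n (λ k → N n k * M k m) ≈ 0#) →
    (∀ n → Σ n (λ k → N n k * M k n) ≈ 1#) →
    ∀ (U V : ℕ → Carrier) → (∀ n → U n ≈ Σ n (λ k → M n k * V k)) → ∀ n → V n ≈ Σ n (λ k → N n k * U k)
  lowerTriangular-leftInverse-solve M N M-lower NM-offDiag NM-diag U V U≈MV n = sym (begin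
    Σ n (λ k → N n k * U k)
      ≈⟨ sumTo-cong n (λ k → trans (*-congˡ (U≈MV k)) (*-distribˡ-sumTo k (N n k) _)) ⟩
    Σ n (λ k → Σ k (λ m → N n k * (M k m * V m)))
      ≈⟨ sumTo-cong-≤ n (λ k k≤n → sumTo-extend k n _ k≤n (λ m k<m →
           trans (*-congˡ (trans (*-congʳ (M-lower k<m)) (zeroˡ _))) (zeroʳ _))) ⟩
    Σ n (λ k → Σ n (λ m → N n k * (M k m * V m)))
      ≈⟨ sumTo-comm n n _ ⟩
    Σ n (λ m → Σ n (λ k → N n k * (M k m * V m)))
      ≈⟨ sumTo-cong n (λ m → trans (sumTo-cong n (λ k → sym (*-assoc _ _ _))) (sym (*-distribʳ-sumTo n (V m) _))) ⟩
    Σ n (λ m → Σ n (λ k → N n k * M k m) * V m)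
      ≈⟨ sumTo-last n _ (λ m m<n → trans (*-congʳ (NM-offDiag m<n)) (zeroˡ _)) ⟩
    Σ n (λ k → N n k * M k n) * V n
      ≈⟨ trans (*-congʳ (NM-diag n)) (*-identityˡ _) ⟩
    V n ∎)
    where open ≈-Reasoning

  riordan-inversion : ∀ {G P H R} → P 0 ≈ 0# → R 0 ≈ 0# → P ∘ₛ R ≋ tₛ → H *ₛ G ∘ₛ R ≋ 1ₛ →
    ∀ (U V : ℕ → Carrier) → (∀ n → U n ≈ Σ n (λ k → riordan G P n k * V k)) →
            ∀ n → V n ≈ Σ n (λ k → riordan H R n k * U k)
  riordan-inversion {G} {P} {H} {R} P₀ R₀ P∘R≋t HG≋1 =
    lowerTriangular-leftInverse-solve (riordan G P) (riordan H R) (riordan-lowerTriangular P₀ G)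
      (λ {n} {m} m<n → trans (product n m) (riordan-identity-< m<n))
      (λ n → trans (product n n) (riordan-identity-≡ n))
    where
    product : ∀ n m → Σ n (λ k → riordan H R n k * riordan G P k m) ≈ riordan 1ₛ tₛ n m
    product n m = trans (riordan-* R₀ H G P n m) (riordan-cong HG≋1 P∘R≋t n m)

  egfShift-shiftWithOne : ∀ a → egfShift Q (shiftWithOne Q a) ≋ 1ₛ +ₛ egf₁ Q a
  egfShift-shiftWithOne a zero    = trans (*-identityʳ _) (sym (+-identityʳ _))
  egfShift-shiftWithOne a (suc n) = sym (+-identityˡ _)

  -- The sequence ((-1)^{j-1}(j-1)!) encodes Σ (-1)ʲ tʲ = (1 + t)⁻¹.
  egfShift-signFact-*ₛ-1+t : egfShift Q (signFact Q) *ₛ (1ₛ +ₛ tₛ) ≋ 1ₛ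
  egfShift-signFact-*ₛ-1+t = ≋-trans (*ₛ-comm _ (1ₛ +ₛ tₛ)) (≋-trans (*ₛ-distribʳ-+ₛ 1ₛ tₛ C) coeff)
    where
    C : Series Q
    C = egfShift Q (signFact Q)
    C≈signPow : ∀ n → C n ≈ signPow Q n
    C≈signPow n = trans (*-assoc _ _ _) (trans (*-congˡ (ι-!-*-invFact n)) (*-identityʳ _))
    coeff : 1ₛ *ₛ C +ₛ tₛ *ₛ C ≋ 1ₛ
    coeff zero    = trans (+-cong (trans (*ₛ-identityˡ C 0) (C≈signPow 0)) (zeroˡ _)) (+-identityʳ _)
    coeff (suc n) = trans (+-cong (trans (*ₛ-identityˡ C (suc n)) (C≈signPow (suc n)))
                                  (trans (tₛ-*ₛ-suc C n) (C≈signPow n)))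
                          (-‿inverseˡ _)

  rBell-inverse-left : ∀ a abar → egf₁ Q a ∘ₛ egf₁ Q abar ≋ tₛ →
    egfShift Q (signFact Q) *ₛ egfShift Q (shiftWithOne Q a) ∘ₛ egf₁ Q abar ≋ 1ₛ
  rBell-inverse-left a abar A∘Ā≋t = ≋-trans (*ₛ-congˡ 1+A∘Ā≋1+t) egfShift-signFact-*ₛ-1+t
    where
    1+A∘Ā≋1+t : egfShift Q (shiftWithOne Q a) ∘ₛ egf₁ Q abar ≋ 1ₛ +ₛ tₛ
    1+A∘Ā≋1+t = ≋-trans (∘ₛ-congˡ _ (egfShift-shiftWithOne a))
      (≋-trans (+ₛ-∘ₛ 1ₛ _ _) (+ₛ-cong (1ₛ-∘ₛ _) A∘Ā≋t))

  rBell-inverse-right : ∀ a → egfShift Q (shiftWithOne Q a) *ₛ egfShift Q (signFact Q) ∘ₛ egf₁ Q a ≋ 1ₛ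
  rBell-inverse-right a = ≋-trans (*ₛ-congʳ {egfShift Q (signFact Q) ∘ₛ egf₁ Q a} 1+A≋[1+t]∘A)
    (*ₛ-inverse-∘ₛ refl (≋-trans (*ₛ-comm (1ₛ +ₛ tₛ) (egfShift Q (signFact Q))) egfShift-signFact-*ₛ-1+t))
    where
    1+A≋[1+t]∘A : egfShift Q (shiftWithOne Q a) ≋ (1ₛ +ₛ tₛ) ∘ₛ egf₁ Q a
    1+A≋[1+t]∘A = ≋-trans (egfShift-shiftWithOne a)
      (≋-sym (≋-trans (+ₛ-∘ₛ 1ₛ tₛ _) (+ₛ-cong (1ₛ-∘ₛ _) (tₛ-∘ₛ refl))))

mainTheorem3 : ∀ {c ℓ} (Q : QAlgebra c ℓ) (r : ℕ)
    (a abar : ℕ → QAlgebra.Carrier Q) →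
    ¬ (QAlgebra._≈_ Q (a 1) (QAlgebra.0# Q)) →
    (∀ n → QAlgebra._≈_ Q (_∘S_ Q (egf₁ Q a) (egf₁ Q abar) n) (tS Q n)) →
    (∀ n → QAlgebra._≈_ Q (_∘S_ Q (egf₁ Q abar) (egf₁ Q a) n) (tS Q n)) →
    (U V : ℕ → QAlgebra.Carrier Q) →
    (∀ n → QAlgebra._≈_ Q (U n)
       (sumTo Q n (λ k → QAlgebra._*_ Q (rBell Q r a (shiftWithOne Q a) n k) (V k))))
    ⇔
    (∀ n → QAlgebra._≈_ Q (V n)
       (sumTo Q n (λ k → QAlgebra._*_ Q (rBell Q r abar (signFact Q) n k) (U k))))
mainTheorem3 Q r a abar _ A∘Ā≋t Ā∘A≋t U V = mk⇔
  (riordan-inversion refl refl A∘Ā≋t (^ₛ-inverse-∘ₛ refl r (rBell-inverse-left a abar A∘Ā≋t)) U V)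
  (riordan-inversion refl refl Ā∘A≋t (^ₛ-inverse-∘ₛ refl r (rBell-inverse-right a)) V U)
  where
  open QAlgebra Q using (refl)
  open SeriesAlgebra Q
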